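{- Let $n$ be a positive integer. Then there is no binary isolation of the unary lattice $\langle n\rangle$; that is, there is no positive definite binary $\mathbb{Z}$-lattice $L$ with $\mathfrak{s}L\subseteq\mathbb{Z}$ which represents $nk^2$ for every integer $k\ge 2$ but does not represent $n$.
   Context: A $\mathbb{Z}$-lattice is a free $\mathbb{Z}$-module with a positive definite symmetric bilinear form $B$ (rational values), $Q(x)=B(x,x)$; its scale ideal $\mathfrak{s}L$ is the $\mathbb{Z}$-module generated by all $B(x,y)$, $x,y\in L$. $\langle n\rangle$ denotes the rank one lattice $\mathbb{Z}e$ with $Q(e)=n$; its proper sublattices are $\langle nk^2\rangle$, $k\ge2$. An isolation of a lattice $\ell$ is a $\mathbb{Z}$-lattice $L$ with $\mathfrak{s}L\subseteq\mathbb{Z}$ that represents every proper sublattice (sublattice of the same rank and index $>1$) of $\ell$ but does not represent $\ell$. An integer $m$ is represented by $L$ if $Q(x)=m$ for some $x\in L$. -}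

module Defs where

open import Data.Nat using (ℕ; _≥_)
open import Data.Integer using (ℤ; +_; _+_; _*_; _<_; 0ℤ)
open import Data.Product using (_×_; ∃₂)
open import Relation.Binary.PropositionalEquality using (_≡_)
open import Relation.Nullary using (¬_)

-- A binary Z-lattice L = Z e₁ ⊕ Z e₂ with symmetric bilinear form B,
-- given by its Gram matrix [[a , b] , [b , c]] w.r.t. the basis (e₁, e₂):
-- a = B(e₁,e₁), b = B(e₁,e₂) = B(e₂,e₁), c = B(e₂,e₂).
-- The scale condition sL ⊆ Z is equivalent to all Gram entries being
-- integers, so the entries are taken in ℤ.
record BinaryLattice : Set where
  field
    a b c : ℤ

open BinaryLattice public

B : BinaryLattice → ℤ → ℤ → ℤ → ℤ → ℤ
B L x₁ y₁ x₂ y₂ = a L * x₁ * x₂ + b L * x₁ * y₂ + b L * y₁ * x₂ + c L * y₁ * y₂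

Q : BinaryLattice → ℤ → ℤ → ℤ
Q L x y = B L x y x y

PositiveDefinite : BinaryLattice → Set
PositiveDefinite L = ∀ x y → ¬ (x ≡ 0ℤ × y ≡ 0ℤ) → 0ℤ < Q L x y

Represents : BinaryLattice → ℤ → Set
Represents L m = ∃₂ λ x y → Q L x y ≡ m

IsIsolationOfUnary : BinaryLattice → ℕ → Set
IsIsolationOfUnary L n =
  (∀ (k : ℕ) → k ≥ 2 → Represents L (+ (n Data.Nat.* k Data.Nat.* k)))
  × ¬ Represents L (+ n)

-- Positive definiteness gives det L = ac - b² > 0, so 4 det L - 1 ≡ 3 (mod 4) has a prime
-- factor q ≡ 3 (mod 4).  Completing the square,
--   (2(ax + by))² + y² = 4a Q(x,y) - (4 det L - 1) y²,
-- so q ∣ Q(x,y) gives q ∣ (2(ax + by))² + y², and since -1 is not a square modulo q this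
-- forces q ∣ y; exchanging the basis vectors, also q ∣ x.  Hence every representation of
-- n q² by L is q times a representation of n.
-- That no m ≡ 3 (mod 4) divides u² + 1 is shown by descent: u may be replaced by an even
-- v < m with m ∣ v² + 1, and then v² + 1 = t m with t < m and t ≡ 3 (mod 4).
module Submission where

open import Defs
open import Data.Nat using (ℕ; _≥_)
open import Data.Product using (Σ; _×_; _,_; ∃-syntax)
open import Relation.Nullary using (¬_)

module _ where
  open import Data.List.Base using ([]; _∷_)
  open import Data.List.Membership.Propositional using (_∈_)
  open import Data.List.Relation.Unary.All as All using ()
  open import Data.List.Relation.Unary.Any using (here; there)
  open import Data.Nat using (suc; _+_; _*_; _∸_; _<_; _≤_; s≤s; z≤n; NonZero)
  open import Data.Nat.Coprimality using (Coprime; coprime-Bézout)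
  open import Data.Nat.DivMod
  open import Data.Nat.Divisibility
  open import Data.Nat.GCD using (module Bézout)
  open import Data.Nat.Induction using (<-wellFounded)
  open import Data.Nat.ListAction using (product)
  open import Data.Nat.ListAction.Properties using (∈⇒∣product)
  open import Data.Nat.Primality using (Prime; prime⇒irreducible)
  open import Data.Nat.Primality.Factorisation using (factorise; PrimeFactorisation)
  open import Data.Nat.Properties
  open import Data.Nat.Tactic.RingSolver using (solve-∀; solve)
  open import Data.Sum using (_⊎_; inj₁; inj₂)
  open import Induction.WellFounded using (Acc; acc)
  open import Relation.Binary.PropositionalEquality
  open import Relation.Nullary using (yes; no; contradiction)

  [m*n]%4≡3⇒m%4≡3⊎n%4≡3 : ∀ m n → (m * n) % 4 ≡ 3 → m % 4 ≡ 3 ⊎ n % 4 ≡ 3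
  [m*n]%4≡3⇒m%4≡3⊎n%4≡3 m n mn≡3 =
    residues (m % 4) (n % 4) (m%n<n m 4) (m%n<n n 4) (trans (sym (%-distribˡ-* m n 4)) mn≡3)
    where
    residues : ∀ r s → r < 4 → s < 4 → (r * s) % 4 ≡ 3 → r ≡ 3 ⊎ s ≡ 3
    residues 3 _ _ _ _ = inj₁ refl
    residues _ 3 _ _ _ = inj₂ refl
    residues 0 _ _ _ ()
    residues 1 0 _ _ ()
    residues 1 1 _ _ ()
    residues 1 2 _ _ ()
    residues 2 0 _ _ ()
    residues 2 1 _ _ ()
    residues 2 2 _ _ ()
    residues (suc (suc (suc (suc _)))) _ (s≤s (s≤s (s≤s (s≤s ())))) _ _
    residues _ (suc (suc (suc (suc _)))) _ (s≤s (s≤s (s≤s (s≤s ())))) _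

  [m*n]%4≡1∧n%4≡3⇒m%4≡3 : ∀ m n → (m * n) % 4 ≡ 1 → n % 4 ≡ 3 → m % 4 ≡ 3
  [m*n]%4≡1∧n%4≡3⇒m%4≡3 m n mn≡1 n≡3 = residues (m % 4) (m%n<n m 4) (begin
    (m % 4 * 3) % 4       ≡⟨ cong (λ s → (m % 4 * s) % 4) n≡3 ⟨
    (m % 4 * (n % 4)) % 4 ≡⟨ %-distribˡ-* m n 4 ⟨
    (m * n) % 4           ≡⟨ mn≡1 ⟩
    1                     ∎)
    where
    open ≡-Reasoning
    residues : ∀ r → r < 4 → (r * 3) % 4 ≡ 1 → r ≡ 3
    residues 3 _ _ = refl
    residues 0 _ ()
    residues 1 _ ()
    residues 2 _ ()
    residues (suc (suc (suc (suc _)))) (s≤s (s≤s (s≤s (s≤s ())))) _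

  product%4≡3⇒∃∈%4≡3 : ∀ ps → product ps % 4 ≡ 3 → ∃[ p ] p ∈ ps × p % 4 ≡ 3
  product%4≡3⇒∃∈%4≡3 (p ∷ ps) p*ps≡3 with [m*n]%4≡3⇒m%4≡3⊎n%4≡3 p (product ps) p*ps≡3
  ... | inj₁ p≡3  = p , here refl , p≡3
  ... | inj₂ ps≡3 with q , q∈ps , q≡3 ← product%4≡3⇒∃∈%4≡3 ps ps≡3 = q , there q∈ps , q≡3

  m%4≡3⇒∃primeFactor%4≡3 : ∀ m → m % 4 ≡ 3 → ∃[ q ] Prime q × q ∣ m × q % 4 ≡ 3
  m%4≡3⇒∃primeFactor%4≡3 m@(suc _) m≡3 = primeFactor (factorise m)
    where
    primeFactor : PrimeFactorisation m → ∃[ q ] Prime q × q ∣ m × q % 4 ≡ 3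
    primeFactor record { factors = ps ; isFactorisation = m≡∏ps ; factorsPrime = primes }
      with q , q∈ps , q≡3 ← product%4≡3⇒∃∈%4≡3 ps (subst (λ k → k % 4 ≡ 3) m≡∏ps m≡3) =
      q , All.lookup primes q∈ps , subst (q ∣_) (sym m≡∏ps) (∈⇒∣product q∈ps) , q≡3

  n%2≡0⊎n%2≡1 : ∀ n → n % 2 ≡ 0 ⊎ n % 2 ≡ 1
  n%2≡0⊎n%2≡1 n with n % 2 | m%n<n n 2
  ... | 0           | _ = inj₁ refl
  ... | 1           | _ = inj₂ refl
  ... | suc (suc _) | s≤s (s≤s ())

  m%4≡3⇒m%2≡1 : ∀ m → m % 4 ≡ 3 → m % 2 ≡ 1
  m%4≡3⇒m%2≡1 m m≡3 = trans (sym (m∣n⇒o%n%m≡o%m 2 4 m (divides 2 refl))) (cong (_% 2) m≡3)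

  m%2≡1∧n%2≡1⇒[m∸n]%2≡0 : ∀ {m n} → n ≤ m → m % 2 ≡ 1 → n % 2 ≡ 1 → (m ∸ n) % 2 ≡ 0
  m%2≡1∧n%2≡1⇒[m∸n]%2≡0 {m} {n} n≤m m-odd n-odd with n%2≡0⊎n%2≡1 (m ∸ n)
  ... | inj₁ m∸n-even = m∸n-even
  ... | inj₂ m∸n-odd  = contradiction (begin
    1                          ≡⟨ m-odd ⟨
    m % 2                      ≡⟨ cong (_% 2) (m∸n+n≡m n≤m) ⟨
    (m ∸ n + n) % 2            ≡⟨ %-distribˡ-+ (m ∸ n) n 2 ⟩
    ((m ∸ n) % 2 + n % 2) % 2  ≡⟨ cong₂ (λ i j → (i + j) % 2) m∸n-odd n-odd ⟩
    0                          ∎) λ ()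
    where open ≡-Reasoning

  n%2≡0⇒[n²+1]%4≡1 : ∀ n → n % 2 ≡ 0 → (n * n + 1) % 4 ≡ 1
  n%2≡0⇒[n²+1]%4≡1 n n-even with divides k refl ← m%n≡0⇒n∣m n 2 n-even =
    trans (cong (_% 4) (expand k)) ([m+kn]%n≡m%n 1 (k * k) 4)
    where
    expand : ∀ k → k * 2 * (k * 2) + 1 ≡ 1 + k * k * 4
    expand = solve-∀

  m∣u²+1⇒m∣[u%m]²+1 : ∀ m .{{_ : NonZero m}} u → m ∣ u * u + 1 → m ∣ u % m * (u % m) + 1
  m∣u²+1⇒m∣[u%m]²+1 m u m∣ = m%n≡0⇒n∣m _ m (begin
    (u % m * (u % m) + 1) % m            ≡⟨ %-distribˡ-+ (u % m * (u % m)) 1 m ⟩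
    ((u % m * (u % m)) % m + 1 % m) % m  ≡⟨ cong (λ k → (k + 1 % m) % m) (%-distribˡ-* u u m) ⟨
    ((u * u) % m + 1 % m) % m            ≡⟨ %-distribˡ-+ (u * u) 1 m ⟨
    (u * u + 1) % m                      ≡⟨ n∣m⇒m%n≡0 _ m m∣ ⟩
    0                                    ∎)
    where open ≡-Reasoning

  v+r∣r²+1⇒v+r∣v²+1 : ∀ v r → v + r ∣ r * r + 1 → v + r ∣ v * v + 1
  v+r∣r²+1⇒v+r∣v²+1 v r v+r∣ =
    ∣m+n∣m⇒∣n (subst (v + r ∣_) (expand v r) (∣m∣n⇒∣m+n (m∣m*n (v + r)) v+r∣)) (m∣m*n (r * 2))
    where
    expand : ∀ v r → (v + r) * (v + r) + (r * r + 1) ≡ (v + r) * (r * 2) + (v * v + 1)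
    expand = solve-∀

  m∣u²+1⇒∃evenRoot< : ∀ m .{{_ : NonZero m}} u → m % 2 ≡ 1 → m ∣ u * u + 1 →
                      ∃[ v ] v % 2 ≡ 0 × v < m × m ∣ v * v + 1
  m∣u²+1⇒∃evenRoot< m u m-odd m∣ with n%2≡0⊎n%2≡1 (u % m)
  ... | inj₁ r-even = u % m , r-even , m%n<n u m , m∣u²+1⇒m∣[u%m]²+1 m u m∣
  ... | inj₂ r-odd  =
    m ∸ r , m%2≡1∧n%2≡1⇒[m∸n]%2≡0 r≤m m-odd r-odd , ∸-monoʳ-< 0<r r≤m ,
    subst (λ k → k ∣ (m ∸ r) * (m ∸ r) + 1) m∸r+r≡m
      (v+r∣r²+1⇒v+r∣v²+1 (m ∸ r) r (subst (_∣ r * r + 1) (sym m∸r+r≡m) (m∣u²+1⇒m∣[u%m]²+1 m u m∣)))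
    where
    r = u % m
    r≤m : r ≤ m
    r≤m = m%n≤n u m
    m∸r+r≡m : m ∸ r + r ≡ m
    m∸r+r≡m = m∸n+n≡m r≤m
    0<r : 0 < r
    0<r = n≢0⇒n>0 λ r≡0 → contradiction (trans (sym r-odd) (cong (_% 2) r≡0)) λ ()

  1<m∧v<m⇒v²+1<m² : ∀ {m v} → 1 < m → v < m → v * v + 1 < m * m
  1<m∧v<m⇒v²+1<m² {suc (suc k)} {v} (s≤s (s≤s z≤n)) (s≤s v≤1+k) = begin-strict
    v * v + 1                            ≤⟨ +-monoˡ-≤ 1 (*-mono-≤ v≤1+k v≤1+k) ⟩
    suc k * suc k + 1                    <⟨ m<m+n _ (s≤s z≤n) ⟩
    suc k * suc k + 1 + (2 + k * 2)      ≡⟨ expand k ⟩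
    suc (suc k) * suc (suc k)            ∎
    where
    open ≤-Reasoning
    expand : ∀ k → suc k * suc k + 1 + (2 + k * 2) ≡ suc (suc k) * suc (suc k)
    expand = solve-∀

  m%4≡3⇒m∤u²+1 : ∀ m u → m % 4 ≡ 3 → ¬ m ∣ u * u + 1
  m%4≡3⇒m∤u²+1 m = descent m (<-wellFounded m)
    where
    descent : ∀ m → Acc _<_ m → ∀ u → m % 4 ≡ 3 → ¬ m ∣ u * u + 1
    descent m@(suc (suc _)) (acc smaller) u m≡3 m∣
      with v , v-even , v<m , divides t v²+1≡tm ← m∣u²+1⇒∃evenRoot< m u (m%4≡3⇒m%2≡1 m m≡3) m∣ =
      descent t (smaller t<m) v t≡3 (divides m (trans v²+1≡tm (*-comm t m)))
      where
      t≡3 : t % 4 ≡ 3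
      t≡3 = [m*n]%4≡1∧n%4≡3⇒m%4≡3 t m
              (trans (cong (_% 4) (sym v²+1≡tm)) (n%2≡0⇒[n²+1]%4≡1 v v-even)) m≡3
      t<m : t < m
      t<m = *-cancelʳ-< m t m (subst (_< m * m) v²+1≡tm (1<m∧v<m⇒v²+1<m² (s≤s (s≤s z≤n)) v<m))

  coprime∧∣X²+Y²⇒∃∣u²+1 : ∀ {q X Y} → Coprime q Y → q ∣ X * X + Y * Y → ∃[ u ] q ∣ u * u + 1
  coprime∧∣X²+Y²⇒∃∣u²+1 {q} {X} {Y} q⊥Y q∣ with coprime-Bézout q⊥Y
  ... | Bézout.-+ x y 1+xq≡yY =
    y * X , ∣m+n∣m⇒∣n (subst (q ∣_) expand (∣n⇒∣m*n (y * y) q∣)) (m∣m*n _)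
    where
    open ≡-Reasoning
    expand : y * y * (X * X + Y * Y) ≡ q * (x * 2 + x * x * q) + (y * X * (y * X) + 1)
    expand = begin
      y * y * (X * X + Y * Y)
        ≡⟨ solve (y ∷ X ∷ Y ∷ []) ⟩
      y * X * (y * X) + y * Y * (y * Y)
        ≡⟨ cong (λ w → y * X * (y * X) + w * w) 1+xq≡yY ⟨
      y * X * (y * X) + (1 + x * q) * (1 + x * q)
        ≡⟨ solve (y ∷ X ∷ x ∷ q ∷ []) ⟩
      q * (x * 2 + x * x * q) + (y * X * (y * X) + 1)
        ∎
  ... | Bézout.+- x y 1+yY≡xq =
    y * X , ∣m+n∣m⇒∣n (subst (q ∣_) expand q∣lhs) (m∣m*n _)
    where
    open ≡-Reasoning
    q∣lhs : q ∣ y * y * (X * X + Y * Y) + q * (x * 2)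
    q∣lhs = ∣m∣n⇒∣m+n (∣n⇒∣m*n (y * y) q∣) (m∣m*n (x * 2))
    expand : y * y * (X * X + Y * Y) + q * (x * 2) ≡ q * (x * x * q) + (y * X * (y * X) + 1)
    expand = begin
      y * y * (X * X + Y * Y) + q * (x * 2)
        ≡⟨ solve (y ∷ X ∷ Y ∷ q ∷ x ∷ []) ⟩
      y * X * (y * X) + y * Y * (y * Y) + x * q * 2
        ≡⟨ cong (λ w → y * X * (y * X) + y * Y * (y * Y) + w * 2) 1+yY≡xq ⟨
      y * X * (y * X) + y * Y * (y * Y) + (1 + y * Y) * 2
        ≡⟨ solve (y ∷ X ∷ Y ∷ []) ⟩
      y * X * (y * X) + 1 + (1 + y * Y) * (1 + y * Y)
        ≡⟨ cong (λ w → y * X * (y * X) + 1 + w * w) 1+yY≡xq ⟩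
      y * X * (y * X) + 1 + x * q * (x * q)
        ≡⟨ solve (y ∷ X ∷ x ∷ q ∷ []) ⟩
      q * (x * x * q) + (y * X * (y * X) + 1)
        ∎

  prime%4≡3∧∣X²+Y²⇒∣Y : ∀ {q X Y} → Prime q → q % 4 ≡ 3 → q ∣ X * X + Y * Y → q ∣ Y
  prime%4≡3∧∣X²+Y²⇒∣Y {q} {X} {Y} q-prime q≡3 q∣ with q ∣? Y
  ... | yes q∣Y = q∣Y
  ... | no q∤Y  = contradiction (coprime∧∣X²+Y²⇒∃∣u²+1 {X = X} q⊥Y q∣)
                    λ (u , q∣u²+1) → m%4≡3⇒m∤u²+1 q u q≡3 q∣u²+1
    where
    q⊥Y : Coprime q Y
    q⊥Y (d∣q , d∣Y) with prime⇒irreducible q-prime d∣q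
    ... | inj₁ d≡1  = d≡1
    ... | inj₂ refl = contradiction d∣Y q∤Y

open import Data.Integer.Base
  using (ℤ; +_; +[1+_]; -[1+_]; 0ℤ; 1ℤ; -_; _+_; _-_; _*_; _<_; +<+; ∣_∣; nonNegative)
open import Data.Integer.Divisibility.Signed
  using (_∣_; divides; ∣ᵤ⇒∣; ∣⇒∣ᵤ; ∣m∣n⇒∣m-n; ∣n⇒∣m*n; ∣m⇒∣m*n)
open import Data.Integer.Properties
  using (*-comm; *-zeroʳ; pos-*; *-cancelʳ-≡; *-cancelˡ-<-nonNeg; <⇒≤; <-irrefl)
open import Data.Integer.Tactic.RingSolver using (solve-∀)
import Data.Nat as ℕ
import Data.Nat.Divisibility as ℕ
import Data.Nat.Properties as ℕ
open import Data.Nat.DivMod using (_%_; %-remove-+ʳ)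
open import Data.Nat.Primality using (Prime; prime⇒nonZero; prime⇒nonTrivial)
open import Relation.Binary.PropositionalEquality

i*i≡+∣i∣*∣i∣ : ∀ i → i * i ≡ + (∣ i ∣ ℕ.* ∣ i ∣)
i*i≡+∣i∣*∣i∣ (+ n)    = sym (pos-* n n)
i*i≡+∣i∣*∣i∣ -[1+ n ] = refl

prime%4≡3∧∣X²+Y²⇒∣Yᶻ : ∀ {q X Y} → Prime q → q % 4 ≡ 3 → + q ∣ X * X + Y * Y → + q ∣ Y
prime%4≡3∧∣X²+Y²⇒∣Yᶻ {q} {X} {Y} q-prime q≡3 q∣ = ∣ᵤ⇒∣ (prime%4≡3∧∣X²+Y²⇒∣Y {X = ∣ X ∣} q-prime q≡3
  (subst (q ℕ.∣_) (cong ∣_∣ (cong₂ _+_ (i*i≡+∣i∣*∣i∣ X) (i*i≡+∣i∣*∣i∣ Y))) (∣⇒∣ᵤ q∣)))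

-- ∣ + 4 * +[1+ d ] - 1ℤ ∣ computes to 4 * suc d ∸ 1.
∣4D-1∣%4≡3 : ∀ {D} → 0ℤ < D → ∣ + 4 * D - 1ℤ ∣ % 4 ≡ 3
∣4D-1∣%4≡3 {+[1+ d ]} _ =
  trans (cong (λ k → (k ℕ.∸ 1) % 4) (ℕ.*-suc 4 d)) (%-remove-+ʳ 3 {d = 4} (ℕ.m∣m*n d))
∣4D-1∣%4≡3 {+ 0} (+<+ ())

0<D⇒∃primeFactor%4≡3[4D-1] : ∀ {D} → 0ℤ < D → ∃[ q ] Prime q × q % 4 ≡ 3 × + q ∣ + 4 * D - 1ℤ
0<D⇒∃primeFactor%4≡3[4D-1] {D} 0<D
  with q , q-prime , q∣ , q≡3 ← m%4≡3⇒∃primeFactor%4≡3 ∣ + 4 * D - 1ℤ ∣ (∣4D-1∣%4≡3 0<D) =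
  q , q-prime , q≡3 , ∣ᵤ⇒∣ q∣

det : BinaryLattice → ℤ
det L = a L * c L - b L * b L

swapBasis : BinaryLattice → BinaryLattice
swapBasis L = record { a = c L ; b = b L ; c = a L }

Q-swapBasis : ∀ L x y → Q (swapBasis L) y x ≡ Q L x y
Q-swapBasis L x y = identity (a L) (b L) (c L) x y
  where
  identity : ∀ a b c x y → c * y * y + b * y * x + b * x * y + a * x * x
                         ≡ a * x * x + b * x * y + b * y * x + c * y * y
  identity = solve-∀

det-swapBasis : ∀ L → det (swapBasis L) ≡ det L
det-swapBasis L = cong (_- b L * b L) (*-comm (c L) (a L))

Q-scale : ∀ L x y k → Q L (x * k) (y * k) ≡ Q L x y * (k * k)
Q-scale L x y k = identity (a L) (b L) (c L) x y k
  where
  identity : ∀ a b c x y k →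
    a * (x * k) * (x * k) + b * (x * k) * (y * k) + b * (y * k) * (x * k) + c * (y * k) * (y * k)
      ≡ (a * x * x + b * x * y + b * y * x + c * y * y) * (k * k)
  identity = solve-∀

Q-completeSquare : ∀ L x y → let X = + 2 * (a L * x + b L * y) in
                   X * X + y * y ≡ + 4 * a L * Q L x y - (+ 4 * det L - 1ℤ) * (y * y)
Q-completeSquare L x y = identity (a L) (b L) (c L) x y
  where
  identity : ∀ a b c x y →
    (+ 2 * (a * x + b * y)) * (+ 2 * (a * x + b * y)) + y * y
      ≡ + 4 * a * (a * x * x + b * x * y + b * y * x + c * y * y)
        - (+ 4 * (a * c - b * b) - 1ℤ) * (y * y)
  identity = solve-∀

Q[1,0]≡a : ∀ L → Q L 1ℤ 0ℤ ≡ a L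
Q[1,0]≡a L = identity (a L) (b L) (c L)
  where
  identity : ∀ a b c → a * 1ℤ * 1ℤ + b * 1ℤ * 0ℤ + b * 0ℤ * 1ℤ + c * 0ℤ * 0ℤ ≡ a
  identity = solve-∀

Q[-b,a]≡a*det : ∀ L → Q L (- b L) (a L) ≡ a L * det L
Q[-b,a]≡a*det L = identity (a L) (b L) (c L)
  where
  identity : ∀ a b c → a * - b * - b + b * - b * a + b * a * - b + c * a * a ≡ a * (a * c - b * b)
  identity = solve-∀

positiveDefinite⇒0<a : ∀ {L} → PositiveDefinite L → 0ℤ < a L
positiveDefinite⇒0<a {L} L-positive = subst (0ℤ <_) (Q[1,0]≡a L) (L-positive 1ℤ 0ℤ λ ())

positiveDefinite⇒0<det : ∀ {L} → PositiveDefinite L → 0ℤ < det L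
positiveDefinite⇒0<det {L} L-positive = *-cancelˡ-<-nonNeg (a L) {{nonNegative (<⇒≤ 0<a)}}
  (subst₂ _<_ (sym (*-zeroʳ (a L))) (Q[-b,a]≡a*det L)
    (L-positive (- b L) (a L) λ (_ , a≡0) → <-irrefl (sym a≡0) 0<a))
  where
  0<a : 0ℤ < a L
  0<a = positiveDefinite⇒0<a {L} L-positive

∣Q⇒∣y : ∀ {q} → Prime q → q % 4 ≡ 3 → ∀ L {x y} → + q ∣ + 4 * det L - 1ℤ → + q ∣ Q L x y → + q ∣ y
∣Q⇒∣y {q} q-prime q≡3 L {x} {y} q∣4det-1 q∣Q =
  prime%4≡3∧∣X²+Y²⇒∣Yᶻ {X = + 2 * (a L * x + b L * y)} q-prime q≡3
    (subst (+ q ∣_) (sym (Q-completeSquare L x y))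
      (∣m∣n⇒∣m-n (∣n⇒∣m*n (+ 4 * a L) q∣Q) (∣m⇒∣m*n (y * y) q∣4det-1)))

∣Q⇒∣x : ∀ {q} → Prime q → q % 4 ≡ 3 → ∀ L {x y} → + q ∣ + 4 * det L - 1ℤ → + q ∣ Q L x y → + q ∣ x
∣Q⇒∣x {q} q-prime q≡3 L {x} {y} q∣4det-1 q∣Q = ∣Q⇒∣y q-prime q≡3 (swapBasis L) {y} {x}
  (subst (λ D → + q ∣ + 4 * D - 1ℤ) (sym (det-swapBasis L)) q∣4det-1)
  (subst (+ q ∣_) (sym (Q-swapBasis L x y)) q∣Q)

∣x∧∣y⇒representsQuotient : ∀ L n {q} .{{_ : ℕ.NonZero q}} {x y} →
                           + q ∣ x → + q ∣ y → Q L x y ≡ + (n ℕ.* q ℕ.* q) → Represents L (+ n)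
∣x∧∣y⇒representsQuotient L n {q} (divides x′ refl) (divides y′ refl) Q≡nqq =
  x′ , y′ , *-cancelʳ-≡ (Q L x′ y′) (+ n) (+ (q ℕ.* q)) {{ℕ.m*n≢0 q q}} (begin
    Q L x′ y′ * + (q ℕ.* q)     ≡⟨ cong (Q L x′ y′ *_) (pos-* q q) ⟩
    Q L x′ y′ * (+ q * + q)     ≡⟨ Q-scale L x′ y′ (+ q) ⟨
    Q L (x′ * + q) (y′ * + q)   ≡⟨ Q≡nqq ⟩
    + (n ℕ.* q ℕ.* q)           ≡⟨ cong +_ (ℕ.*-assoc n q q) ⟩
    + (n ℕ.* (q ℕ.* q))         ≡⟨ pos-* n (q ℕ.* q) ⟩
    + n * + (q ℕ.* q)           ∎)
  where open ≡-Reasoning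

theorem2p4 : (n : ℕ) → n ≥ 1 →
    ¬ (Σ BinaryLattice λ L → PositiveDefinite L × IsIsolationOfUnary L n)
theorem2p4 n _ (L , L-positive , represents-nk² , ¬represents-n)
  with q , q-prime , q≡3 , q∣4det-1
         ← 0<D⇒∃primeFactor%4≡3[4D-1] (positiveDefinite⇒0<det {L} L-positive)
  with x , y , Q≡nqq ← represents-nk² q (ℕ.nonTrivial⇒n>1 q {{prime⇒nonTrivial q-prime}}) =
  ¬represents-n (∣x∧∣y⇒representsQuotient L n {{prime⇒nonZero q-prime}}
    (∣Q⇒∣x q-prime q≡3 L q∣4det-1 q∣Q) (∣Q⇒∣y q-prime q≡3 L q∣4det-1 q∣Q) Q≡nqq)
  where
  q∣Q : + q ∣ Q L x y
  q∣Q = subst (+ q ∣_) (sym Q≡nqq) (∣ᵤ⇒∣ (ℕ.n∣m*n (n ℕ.* q)))
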